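{- Let $k$ be a positive integer. Let $G$ be a bipartite graph with bipartition $(U,W)$, $U=\{u_1,\ldots,u_n\}$, $W=\{w_1,\ldots,w_n\}$, and let $M=\{u_iw_i : 1\le i\le n\}$ be a perfect matching of $G$. If $G$ is minimal $k$-extendable, then $D=D(G,M)$ is minimal $k$-strong.
   Context: All graphs and digraphs are finite, without loops and multiple edges/arcs. $D(G,M)$ is the digraph with vertex set $\{v_1,\ldots,v_n\}$ having an arc from $v_i$ to $v_j$ if and only if $i\neq j$ and $u_iw_j\in E(G)$. A digraph is strong if for any two distinct vertices $x,y$ there is a directed path from $x$ to $y$ and one from $y$ to $x$. A set $S\subset V(D)$ is a separator if $D-S$ is not strong. $D$ is $k$-strong if $|V(D)|\ge k+1$ and $D$ has no separator with fewer than $k$ vertices; $D$ is minimal $k$-strong if $D$ is $k$-strong but $D-a$ is not $k$-strong for every arc $a$ of $D$. A connected graph $G$ is $k$-extendable, for $k\le(|V(G)|-1)/2$, if $G$ has a matching of size $k$ and every matching of size $k$ is contained in a perfect matching of $G$; $G$ is minimal $k$-extendable if $G$ is $k$-extendable but $G-e$ is not $k$-extendable for every edge $e$ of $G$. -}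

module Defs where

open import Data.Nat using (ℕ; _+_; _*_; _≤_; _<_)
open import Data.Bool using (Bool; true; false; _∧_; not; if_then_else_)
open import Data.Fin using (Fin; _≟_)
open import Data.Fin.Subset using (Subset; _∉_; ∣_∣)
open import Data.List using (List; map; allFin)
open import Data.Nat.ListAction using (sum)
open import Data.Sum using (_⊎_; inj₁; inj₂)
open import Data.Product using (_×_; Σ; ∃; _,_)
open import Data.Empty using (⊥)
open import Relation.Nullary using (¬_)
open import Relation.Nullary.Decidable using (⌊_⌋)
open import Relation.Binary.PropositionalEquality using (_≡_; _≢_)
open import Relation.Binary.Construct.Closure.ReflexiveTransitive using (Star)

-- Bipartite graphs with bipartition (U , W), U = {u_0..u_{n-1}},
-- W = {w_0..w_{n-1}}.  G i j ≡ true  iff  u_i w_j ∈ E(G).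

BipGraph : ℕ → Set
BipGraph n = Fin n → Fin n → Bool

-- vertices of G: inj₁ i = u_i, inj₂ j = w_j
Vtx : ℕ → Set
Vtx n = Fin n ⊎ Fin n

Adj : ∀ {n} → BipGraph n → Vtx n → Vtx n → Set
Adj G (inj₁ i) (inj₂ j) = G i j ≡ true
Adj G (inj₂ j) (inj₁ i) = G i j ≡ true
Adj G (inj₁ _) (inj₁ _) = ⊥
Adj G (inj₂ _) (inj₂ _) = ⊥

Connected : ∀ {n} → BipGraph n → Set
Connected {n} G = (x y : Vtx n) → Star (Adj G) x y

deleteEdge : ∀ {n} → BipGraph n → Fin n → Fin n → BipGraph n
deleteEdge G a b i j = G i j ∧ not (⌊ i ≟ a ⌋ ∧ ⌊ j ≟ b ⌋)

EdgeSet : ℕ → Set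
EdgeSet n = Fin n → Fin n → Bool

_⊆ₑ_ : ∀ {n} → EdgeSet n → EdgeSet n → Set
m ⊆ₑ m' = ∀ i j → m i j ≡ true → m' i j ≡ true

size : ∀ {n} → EdgeSet n → ℕ
size {n} m = sum (map (λ i → sum (map (λ j → if m i j then 1 else 0) (allFin n))) (allFin n))

IsMatching : ∀ {n} → BipGraph n → EdgeSet n → Set
IsMatching G m =
  (m ⊆ₑ G) ×
  (∀ i j j' → m i j ≡ true → m i j' ≡ true → j ≡ j') ×
  (∀ i i' j → m i j ≡ true → m i' j ≡ true → i ≡ i')

IsPerfectMatching : ∀ {n} → BipGraph n → EdgeSet n → Set
IsPerfectMatching {n} G m =
  IsMatching G m ×
  (∀ i → ∃ λ j → m i j ≡ true) ×
  (∀ j → ∃ λ i → m i j ≡ true)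

-- k-extendable (|V(G)| = 2n; the condition k ≤ (|V(G)|-1)/2 is 2k+1 ≤ 2n)
Extendable : ∀ {n} → ℕ → BipGraph n → Set
Extendable {n} k G =
  Connected G ×
  (2 * k + 1 ≤ 2 * n) ×
  (∃ λ m → IsMatching G m × size m ≡ k) ×
  (∀ m → IsMatching G m → size m ≡ k →
     ∃ λ p → IsPerfectMatching G p × (m ⊆ₑ p))

MinimalExtendable : ∀ {n} → ℕ → BipGraph n → Set
MinimalExtendable k G =
  Extendable k G ×
  (∀ a b → G a b ≡ true → ¬ Extendable k (deleteEdge G a b))

-- Digraphs on vertex set {v_0..v_{n-1}}: A i j ≡ true iff arc v_i → v_j.

Digraph : ℕ → Set
Digraph n = Fin n → Fin n → Bool

D : ∀ {n} → BipGraph n → Digraph n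
D G i j = not ⌊ i ≟ j ⌋ ∧ G i j

deleteArc : ∀ {n} → Digraph n → Fin n → Fin n → Digraph n
deleteArc A a b i j = A i j ∧ not (⌊ i ≟ a ⌋ ∧ ⌊ j ≟ b ⌋)

ArcOutside : ∀ {n} → Digraph n → Subset n → Fin n → Fin n → Set
ArcOutside A S x y = x ∉ S × y ∉ S × A x y ≡ true

StrongWithout : ∀ {n} → Digraph n → Subset n → Set
StrongWithout {n} A S =
  (x y : Fin n) → x ∉ S → y ∉ S → x ≢ y → Star (ArcOutside A S) x y

IsSeparator : ∀ {n} → Digraph n → Subset n → Set
IsSeparator A S = ¬ StrongWithout A S

KStrong : ∀ {n} → ℕ → Digraph n → Set
KStrong {n} k A =
  (k + 1 ≤ n) × (∀ (S : Subset n) → IsSeparator A S → k ≤ ∣ S ∣)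

MinimalKStrong : ∀ {n} → ℕ → Digraph n → Set
MinimalKStrong k A =
  KStrong k A × (∀ a b → A a b ≡ true → ¬ KStrong k (deleteArc A a b))

module Submission where

-- Both directions of the equivalence are proved, for G ⊇ M = {u_i w_i}:
--   (T1)  G k-extendable          ⇒  D(G,M) k-strong,
--   (T2)  D(G,M) k-strong, k ≥ 1  ⇒  G k-extendable.
-- D is k-strong by (T1).  If D - (v_a → v_b) were k-strong then, as a ≢ b, it
-- equals D(G - u_a w_b, M), so G - u_a w_b would be k-extendable by (T2),
-- contradicting the minimality of G.
--
-- First come counting with an injection
-- (pigeonhole) principle, closure of a set under a relation (reachability), and
-- matchings as edge sets (adding, re-routing, padding with M-edges).  (T2) is an
-- augmenting-path argument whose obstruction is a separator of size < k; in (T1)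
-- a separator of size < k yields a matching of size ≤ k whose perfect extension
-- would map a vertex set injectively into a proper subset of itself.

open import Defs
open import Data.Nat using (ℕ; zero; suc; _+_; _*_; _∸_; _≤_; _<_; _≤?_; _<?_; z≤n; s≤s)
open import Data.Nat.Properties
  using (suc-injective; ≤-refl; ≤-reflexive; ≤-trans; ≤-antisym; <⇒≱; <⇒≢; ≰⇒>; ≮⇒≥; n≤1+n; m≤n⇒m≤1+n;
         m≤m+n; +-comm; +-suc; +-identityʳ; +-mono-≤; +-monoˡ-≤; +-monoʳ-≤; +-cancelʳ-≤;
         *-monoʳ-≤; m+[n∸m]≡n; module ≤-Reasoning)
open import Data.Nat.Tactic.RingSolver using (solve-∀)
open import Data.Bool using (Bool; true; false; _∧_; _∨_; not; if_then_else_)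
open import Data.Bool.Properties using (∧-comm; ∧-assoc; ∧-zeroʳ; ∧-identityʳ; ∨-identityʳ)
open import Data.Fin using (Fin; zero; suc; _≟_)
open import Data.Fin.Subset using (Subset; _∉_; ∣_∣)
import Data.Fin.Subset as Subset
open import Data.Fin.Subset.Properties using (∉⊥; ∣⊥∣≡0)
open import Data.Vec using ([]; _∷_; lookup; tabulate)
open import Data.Vec.Properties using ([]=⇒lookup; lookup⇒[]=; lookup∘tabulate)
open import Data.List using (map; allFin)
import Data.List as List
open import Data.List.Properties using (map-cong)
open import Data.Nat.ListAction using (sum)
open import Data.Maybe using (Maybe; just; nothing; fromMaybe)
import Data.Maybe as Maybe
open import Data.Product using (_×_; ∃; _,_; proj₁; proj₂)
open import Data.Sum using (_⊎_; inj₁; inj₂)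
open import Data.Empty using (⊥; ⊥-elim)
open import Relation.Nullary using (¬_; yes; no; Dec)
open import Relation.Nullary.Decidable using (⌊_⌋)
open import Relation.Binary.PropositionalEquality
  using (_≡_; _≢_; refl; sym; trans; cong; cong₂; subst; subst₂; module ≡-Reasoning)
open import Relation.Binary.Construct.Closure.ReflexiveTransitive using (Star; ε; _◅_; _◅◅_) renaming (map to Star-map)
open import Function using (_∘_)

t≢f : true ≢ false
t≢f ()

true≢false-at : ∀ {b} → b ≡ true → b ≡ false → ⊥
true≢false-at refl ()

∧-true : ∀ {a b} → (a ∧ b) ≡ true → a ≡ true × b ≡ true
∧-true {true} {true} _ = refl , refl

∧-intro : ∀ {a b} → a ≡ true → b ≡ true → (a ∧ b) ≡ true
∧-intro refl refl = refl

∨-true : ∀ {a b} → (a ∨ b) ≡ true → a ≡ true ⊎ b ≡ true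
∨-true {true} _ = inj₁ refl
∨-true {false} e = inj₂ e

∨-l : ∀ {a} b → a ≡ true → (a ∨ b) ≡ true
∨-l b refl = refl

∨-r : ∀ a {b} → b ≡ true → (a ∨ b) ≡ true
∨-r true _ = refl
∨-r false e = e

∨-false-l : ∀ {a b} → (a ∨ b) ≡ false → a ≡ false
∨-false-l {false} _ = refl

∨-false-r : ∀ {a b} → (a ∨ b) ≡ false → b ≡ false
∨-false-r {false} e = e

not-true : ∀ {a} → not a ≡ true → a ≡ false
not-true {false} _ = refl

not-false : ∀ {a} → a ≡ false → not a ≡ true
not-false refl = refl

bool-iff : ∀ {x y : Bool} → (x ≡ true → y ≡ true) → (y ≡ true → x ≡ true) → x ≡ y
bool-iff {false} {false} f g = refl
bool-iff {false} {true} f g = ⊥-elim (t≢f (sym (g refl)))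
bool-iff {true} {false} f g = ⊥-elim (t≢f (sym (f refl)))
bool-iff {true} {true} f g = refl

inspect-bool : (b : Bool) → b ≡ true ⊎ b ≡ false
inspect-bool true = inj₁ refl
inspect-bool false = inj₂ refl

eqb : ∀ {n} → Fin n → Fin n → Bool
eqb a b = ⌊ a ≟ b ⌋

eqb-refl : ∀ {n} (a : Fin n) → eqb a a ≡ true
eqb-refl a with a ≟ a
... | yes _ = refl
... | no a≢a = ⊥-elim (a≢a refl)

eqb-false : ∀ {n} {a b : Fin n} → a ≢ b → eqb a b ≡ false
eqb-false {a = a} {b} a≢b with a ≟ b
... | yes a≡b = ⊥-elim (a≢b a≡b)
... | no _ = refl

eqb-false⁻ : ∀ {n} {a b : Fin n} → eqb a b ≡ false → a ≢ b
eqb-false⁻ {a = a} e refl = true≢false-at (eqb-refl a) e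

eqb-true : ∀ {n} {a b : Fin n} → eqb a b ≡ true → a ≡ b
eqb-true {a = a} {b} e with a ≟ b
... | yes p = p
eqb-true {a = a} {b} () | no _

anyF : ∀ {n} → (Fin n → Bool) → Bool
anyF {zero} f = false
anyF {suc n} f = f zero ∨ anyF (f ∘ suc)

anyF-sound : ∀ {n} (f : Fin n → Bool) → anyF f ≡ true → ∃ λ i → f i ≡ true
anyF-sound {suc n} f e with f zero in eq
... | true = zero , eq
... | false with anyF-sound (f ∘ suc) e
... | i , p = suc i , p

anyF-complete : ∀ {n} (f : Fin n → Bool) i → f i ≡ true → anyF f ≡ true
anyF-complete {suc n} f zero p rewrite p = refl
anyF-complete {suc n} f (suc i) p = ∨-r (f zero) (anyF-complete (f ∘ suc) i p)

anyF-false : ∀ {n} (f : Fin n → Bool) → anyF f ≡ false → ∀ i → f i ≡ false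
anyF-false f e i with f i in eq
... | false = refl
... | true = ⊥-elim (true≢false-at (anyF-complete f i eq) e)

anyF-empty : ∀ {n} → anyF {n} (λ _ → false) ≡ false
anyF-empty {zero} = refl
anyF-empty {suc n} = anyF-empty {n}

first : ∀ {n} → (Fin n → Bool) → Maybe (Fin n)
first {zero} f = nothing
first {suc n} f with f zero
... | true = just zero
... | false = Maybe.map suc (first (f ∘ suc))

choose : ∀ {n} → (Fin n → Bool) → Fin n → Fin n
choose f d = fromMaybe d (first f)

first-spec : ∀ {n} (f : Fin n → Bool) j → f j ≡ true → ∃ λ i → first f ≡ just i × f i ≡ true
first-spec {suc n} f j p with f zero in eq
... | true = zero , refl , eq
first-spec {suc n} f zero p | false = ⊥-elim (true≢false-at p eq)
first-spec {suc n} f (suc j) p | false with first-spec (f ∘ suc) j p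
... | i , e , q rewrite e = suc i , refl , q

choose-spec : ∀ {n} (f : Fin n → Bool) d → anyF f ≡ true → f (choose f d) ≡ true
choose-spec f d p with anyF-sound f p
... | j , fj with first-spec f j fj
... | i , e , q rewrite e = q

b2n : Bool → ℕ
b2n b = if b then 1 else 0

count : ∀ {n} → (Fin n → Bool) → ℕ
count {zero} f = 0
count {suc n} f = b2n (f zero) + count (f ∘ suc)

count-ext : ∀ {n} (f g : Fin n → Bool) → (∀ i → f i ≡ g i) → count f ≡ count g
count-ext {zero} f g e = refl
count-ext {suc n} f g e = cong₂ _+_ (cong b2n (e zero)) (count-ext (f ∘ suc) (g ∘ suc) (e ∘ suc))

count-mono : ∀ {n} (f g : Fin n → Bool) → (∀ i → f i ≡ true → g i ≡ true) → count f ≤ count g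
count-mono {zero} f g h = z≤n
count-mono {suc n} f g h = +-mono-≤ (b2n-mono (h zero)) (count-mono (f ∘ suc) (g ∘ suc) (h ∘ suc))
  where
  b2n-mono : ∀ {a b} → (a ≡ true → b ≡ true) → b2n a ≤ b2n b
  b2n-mono {false} h = z≤n
  b2n-mono {true} h rewrite h refl = ≤-refl

count-zero : ∀ {n} (f : Fin n → Bool) → (∀ i → f i ≡ false) → count f ≡ 0
count-zero {zero} f h = refl
count-zero {suc n} f h rewrite h zero = count-zero (f ∘ suc) (h ∘ suc)

count-≤n : ∀ {n} (f : Fin n → Bool) → count f ≤ n
count-≤n {zero} f = z≤n
count-≤n {suc n} f with f zero
... | true = s≤s (count-≤n (f ∘ suc))
... | false = m≤n⇒m≤1+n (count-≤n (f ∘ suc))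

count-full-set : ∀ {n} → count {n} (λ _ → true) ≡ n
count-full-set {zero} = refl
count-full-set {suc n} = cong suc count-full-set

private
  swap-middle : ∀ a b c d → a + b + (c + d) ≡ a + c + (b + d)
  swap-middle = solve-∀

  b2n-split : ∀ a b → b2n a ≡ b2n (a ∧ b) + b2n (a ∧ not b)
  b2n-split false b = refl
  b2n-split true false = refl
  b2n-split true true = refl

count-split : ∀ {n} (f g : Fin n → Bool) →
              count f ≡ count (λ i → f i ∧ g i) + count (λ i → f i ∧ not (g i))
count-split {zero} f g = refl
count-split {suc n} f g rewrite count-split (f ∘ suc) (g ∘ suc) | b2n-split (f zero) (g zero) =
  swap-middle (b2n (f zero ∧ g zero)) _ _ _

count-∪ : ∀ {n} (f g : Fin n → Bool) → count (λ i → f i ∨ g i) ≤ count f + count g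
count-∪ {zero} f g = z≤n
count-∪ {suc n} f g = ≤-trans (+-mono-≤ (b2n-∨ (f zero) (g zero)) (count-∪ (f ∘ suc) (g ∘ suc)))
                               (≤-reflexive (swap-middle (b2n (f zero)) _ _ _))
  where
  b2n-∨ : ∀ a b → b2n (a ∨ b) ≤ b2n a + b2n b
  b2n-∨ false false = z≤n
  b2n-∨ false true = ≤-refl
  b2n-∨ true b = s≤s z≤n

count-compl : ∀ {n} (f : Fin n → Bool) → count f + count (λ i → not (f i)) ≡ n
count-compl {n} f = trans (sym (count-split (λ _ → true) f)) count-full-set

count-singleton : ∀ {n} (a : Fin n) → count (λ i → eqb i a) ≡ 1
count-singleton {suc n} zero = cong suc (count-zero {n} _ (λ i → refl))
count-singleton {suc n} (suc a) = trans (count-ext _ _ eqb-suc) (count-singleton a)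
  where
  eqb-suc : ∀ i → eqb (suc i) (suc a) ≡ eqb i a
  eqb-suc i with i ≟ a
  ... | yes refl = refl
  ... | no _ = refl

count-remove : ∀ {n} (f : Fin n → Bool) a → f a ≡ true →
               count f ≡ suc (count (λ i → f i ∧ not (eqb i a)))
count-remove f a fa = trans (count-split f (λ i → eqb i a))
                            (cong (_+ count (λ i → f i ∧ not (eqb i a))) only-a)
  where
  only-a : count (λ i → f i ∧ eqb i a) ≡ 1
  only-a = trans (count-ext _ _ same) (count-singleton a)
    where
    same : ∀ i → (f i ∧ eqb i a) ≡ eqb i a
    same i with i ≟ a
    ... | yes refl rewrite fa = refl
    ... | no _ with f i
    ... | true = refl
    ... | false = refl

count-insert : ∀ {n} (f : Fin n → Bool) a → f a ≡ false → count (λ i → f i ∨ eqb i a) ≡ suc (count f)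
count-insert f a fa = trans (count-remove _ a (∨-r (f a) (eqb-refl a))) (cong suc (count-ext _ _ same))
  where
  same : ∀ i → ((f i ∨ eqb i a) ∧ not (eqb i a)) ≡ f i
  same i with i ≟ a
  ... | yes refl rewrite fa = refl
  ... | no _ with f i
  ... | true = refl
  ... | false = refl

count-missing : ∀ {n} (f : Fin n → Bool) → count f < n → ∃ λ i → f i ≡ false
count-missing {n} f lt with anyF (λ i → not (f i)) in eq
... | true = let (i , p) = anyF-sound (λ i → not (f i)) eq in i , not-true p
... | false = ⊥-elim (<⇒≢ lt (trans (sym (+-identityʳ _)) (trans (cong (count f +_) (sym none)) (count-compl f))))
  where
  none : count (λ i → not (f i)) ≡ 0
  none = count-zero {n} (λ i → not (f i)) (anyF-false (λ i → not (f i)) eq)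

count-strict : ∀ {n} (f g : Fin n → Bool) a → (∀ i → f i ≡ true → g i ≡ true) → g a ≡ true → f a ≡ false →
               suc (count f) ≤ count g
count-strict f g a sub ga fa = subst (suc (count f) ≤_) (sym (count-remove g a ga)) (s≤s (count-mono f _ f⊆g-a))
  where
  f⊆g-a : ∀ i → f i ≡ true → (g i ∧ not (eqb i a)) ≡ true
  f⊆g-a i e with i ≟ a
  ... | yes refl = ⊥-elim (true≢false-at e fa)
  ... | no _ rewrite sub i e = refl

count-full : ∀ {n} (f : Fin n → Bool) → n ≤ count f → ∀ i → f i ≡ true
count-full {n} f le i with f i in eq
... | true = refl
... | false = ⊥-elim (<⇒≱ lt le)
  where
  lt : count f < n
  lt = subst (count f <_) count-full-set (count-strict f (λ _ → true) i (λ _ _ → refl) refl eq)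

count-member : ∀ {n} (f : Fin n → Bool) {c} → count f ≡ suc c → ∃ λ a → f a ≡ true
count-member f eq with anyF f in any
... | true = anyF-sound f any
... | false with () ← trans (sym eq) (count-zero f (anyF-false f any))

-- Injection principle: a map h that sends f into g and is injective on f
-- witnesses |f| ≤ |g|.  By induction on |f|: remove a member a of f and
-- h a from g.
inj-count : ∀ {n} (f g : Fin n → Bool) (h : Fin n → Fin n) →
            (∀ i → f i ≡ true → g (h i) ≡ true) →
            (∀ i j → f i ≡ true → f j ≡ true → h i ≡ h j → i ≡ j) →
            count f ≤ count g
inj-count f g h maps inj = go (count f) f g refl maps inj
  where
  go : ∀ c (f g : Fin _ → Bool) → count f ≡ c →
       (∀ i → f i ≡ true → g (h i) ≡ true) →
       (∀ i j → f i ≡ true → f j ≡ true → h i ≡ h j → i ≡ j) → count f ≤ count g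
  go zero f g eq maps inj = subst (_≤ count g) (sym eq) z≤n
  go (suc c) f g eq maps inj with count-member f eq
  ... | a , fa = begin-count
    where
    f′ g′ : Fin _ → Bool
    f′ i = f i ∧ not (eqb i a)
    g′ j = g j ∧ not (eqb j (h a))
    f′⊆f : ∀ i → f′ i ≡ true → f i ≡ true
    f′⊆f i e = proj₁ (∧-true e)
    maps′ : ∀ i → f′ i ≡ true → g′ (h i) ≡ true
    maps′ i e with ∧-true {f i} e
    ... | fi , i≢a = ∧-intro (maps i fi)
                       (not-false (eqb-false λ hi≡ha → eqb-false⁻ (not-true i≢a) (inj i a fi fa hi≡ha)))
    begin-count : count f ≤ count g
    begin-count = subst₂ _≤_ (sym (count-remove f a fa)) (sym (count-remove g (h a) (maps a fa)))
                    (s≤s (go c f′ g′ (suc-injective (trans (sym (count-remove f a fa)) eq)) maps′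
                           (λ i j fi fj → inj i j (f′⊆f i fi) (f′⊆f j fj))))

pigeonhole : ∀ {n} (f : Fin n → Bool) r → f r ≡ true → (h : Fin n → Fin n) →
             (∀ i → f i ≡ true → (f (h i) ∧ not (eqb (h i) r)) ≡ true) →
             (∀ i j → f i ≡ true → f j ≡ true → h i ≡ h j → i ≡ j) → ⊥
pigeonhole f r fr h maps inj = <⇒≱ (≤-reflexive (sym (count-remove f r fr))) (inj-count f _ h maps inj)

-- For a Boolean relation E on Fin n and a start set X,
-- iter E t X is the set of vertices reachable from X by at most t E-steps,
-- and closure E X = iter E (suc n) X is the reachable set itself: a chain of
-- strictly growing subsets of Fin n stabilises within n steps.

step : ∀ {n} → (Fin n → Fin n → Bool) → (Fin n → Bool) → (Fin n → Bool)
step E C j = C j ∨ anyF (λ i → C i ∧ E i j)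

iter : ∀ {n} → (Fin n → Fin n → Bool) → ℕ → (Fin n → Bool) → (Fin n → Bool)
iter E zero X = X
iter E (suc t) X = step E (iter E t X)

closure : ∀ {n} → (Fin n → Fin n → Bool) → (Fin n → Bool) → (Fin n → Bool)
closure {n} E X = iter E (suc n) X

Closed : ∀ {n} → (Fin n → Fin n → Bool) → (Fin n → Bool) → Set
Closed E C = ∀ i j → C i ≡ true → E i j ≡ true → C j ≡ true

step-keep : ∀ {n} E (C : Fin n → Bool) j → C j ≡ true → step E C j ≡ true
step-keep E C j p = ∨-l _ p

step-arc : ∀ {n} E (C : Fin n → Bool) i j → C i ≡ true → E i j ≡ true → step E C j ≡ true
step-arc E C i j ci e = ∨-r (C j) (anyF-complete (λ i → C i ∧ E i j) i (∧-intro ci e))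

step-cases : ∀ {n} E (C : Fin n → Bool) j → step E C j ≡ true →
             C j ≡ true ⊎ (C j ≡ false × ∃ λ i → C i ≡ true × E i j ≡ true)
step-cases E C j p with C j in eq
... | true = inj₁ refl
... | false with anyF-sound _ p
... | i , r = inj₂ (refl , i , ∧-true r)

iter-base : ∀ {n} E (X : Fin n → Bool) t j → X j ≡ true → iter E t X j ≡ true
iter-base E X zero j p = p
iter-base E X (suc t) j p = step-keep E _ j (iter-base E X t j p)

closure-base : ∀ {n} E (X : Fin n → Bool) j → X j ≡ true → closure E X j ≡ true
closure-base {n} E X = iter-base E X (suc n)

closed-step : ∀ {n} E (C : Fin n → Bool) → Closed E C → Closed E (step E C)
closed-step E C cl i j p e = step-keep E C j (cl i j (back i p) e)
  where
  back : ∀ j → step E C j ≡ true → C j ≡ true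
  back j p with step-cases E C j p
  ... | inj₁ q = q
  ... | inj₂ (_ , i , q , e) = cl i j q e

iter-grows : ∀ {n} E (X : Fin n → Bool) t → t ≤ count (iter E t X) ⊎ Closed E (iter E t X)
iter-grows E X zero = inj₁ z≤n
iter-grows E X (suc t) with iter-grows E X t
... | inj₂ cl = inj₂ (closed-step E _ cl)
... | inj₁ le with anyF (λ j → step E (iter E t X) j ∧ not (iter E t X j)) in new
... | true with anyF-sound _ new
... | j , p = inj₁ (≤-trans (s≤s le) (count-strict (iter E t X) (step E (iter E t X)) j
                                        (step-keep E _) (proj₁ (∧-true p)) (not-true (proj₂ (∧-true p)))))
iter-grows E X (suc t) | inj₁ le | false = inj₂ (closed-step E _ cl)
  where
  cl : Closed E (iter E t X)
  cl i j ci e with iter E t X j in q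
  ... | true = refl
  ... | false = ⊥-elim (true≢false-at (∧-intro (step-arc E (iter E t X) i j ci e) (not-false q))
                                      (anyF-false _ new j))

closure-closed : ∀ {n} E (X : Fin n → Bool) → Closed E (closure E X)
closure-closed {n} E X with iter-grows E X (suc n)
... | inj₂ cl = cl
... | inj₁ le = ⊥-elim (<⇒≱ (s≤s (count-≤n (iter E (suc n) X))) le)

iter-all : ∀ {n} E (X : Fin n → Bool) (P : Fin n → Set) → (∀ z → X z ≡ true → P z) →
           (∀ x z → E x z ≡ true → P z) → ∀ t z → iter E t X z ≡ true → P z
iter-all E X P base arc zero z p = base z p
iter-all E X P base arc (suc t) z p with step-cases E _ z p
... | inj₁ q = iter-all E X P base arc t z q
... | inj₂ (_ , i , q , e) = arc i z e

closure-all : ∀ {n} E (X : Fin n → Bool) (P : Fin n → Set) → (∀ z → X z ≡ true → P z) →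
              (∀ x z → E x z ≡ true → P z) → ∀ z → closure E X z ≡ true → P z
closure-all {n} E X P base arc = iter-all E X P base arc (suc n)

closure-path : ∀ {n} (Rel : Fin n → Fin n → Set) E x →
               (∀ i j → E i j ≡ true → Rel i j) →
               ∀ y → closure E (λ i → eqb i x) y ≡ true → Star Rel x y
closure-path {n} Rel E x arc = go (suc n)
  where
  go : ∀ t y → iter E t (λ i → eqb i x) y ≡ true → Star Rel x y
  go zero y p with eqb-true p
  ... | refl = ε
  go (suc t) y p with step-cases E _ y p
  ... | inj₁ q = go t y q
  ... | inj₂ (_ , i , q , e) = go t i q ◅◅ (arc i y e ◅ ε)

star-closed : ∀ {n} (Rel : Fin n → Fin n → Set) (C : Fin n → Bool) →
              (∀ i j → C i ≡ true → Rel i j → C j ≡ true) → ∀ {x y} → Star Rel x y → C x ≡ true → C y ≡ true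
star-closed Rel C h ε p = p
star-closed Rel C h (r ◅ s) p = star-closed Rel C h s (h _ _ p r)

iter-transfer : ∀ {n} E E′ (X : Fin n → Bool) c → (∀ x z → E x z ≡ true → z ≢ c → E′ x z ≡ true) →
                ∀ t → iter E t X c ≡ false → ∀ z → iter E t X z ≡ true → iter E′ t X z ≡ true
iter-transfer E E′ X c same zero nc z p = p
iter-transfer E E′ X c same (suc t) nc z p with step-cases E _ z p
... | inj₁ q = step-keep E′ _ z (iter-transfer E E′ X c same t (∨-false-l nc) z q)
... | inj₂ (_ , i , q , e) = step-arc E′ _ i z (iter-transfer E E′ X c same t (∨-false-l nc) i q)
                                  (same i z e (λ { refl → true≢false-at p nc }))

dom : ∀ {n} → EdgeSet n → Fin n → Bool
dom m i = anyF (m i)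

ran : ∀ {n} → EdgeSet n → Fin n → Bool
ran m j = anyF (λ i → m i j)

dom-in : ∀ {n} (m : EdgeSet n) i j → m i j ≡ true → dom m i ≡ true
dom-in m i j = anyF-complete (m i) j

ran-in : ∀ {n} (m : EdgeSet n) i j → m i j ≡ true → ran m j ≡ true
ran-in m i j = anyF-complete (λ i → m i j) i

covered : ∀ {n} → EdgeSet n → Fin n → Bool
covered m i = dom m i ∨ ran m i

-- A matching covers equally many vertices on both sides: m itself injects
-- each side into the other.
ran-count : ∀ {n} (G : BipGraph n) (m : EdgeSet n) → IsMatching G m → count (ran m) ≡ count (dom m)
ran-count {n} G m (_ , row-unique , col-unique) = ≤-antisym
  (inj-count (ran m) (dom m) partnerᵤ (λ j p → dom-in m _ j (partnerᵤ-edge j p))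
     (λ j j' p p' e → row-unique _ j j' (partnerᵤ-edge j p) (subst (λ z → m z j' ≡ true) (sym e) (partnerᵤ-edge j' p'))))
  (inj-count (dom m) (ran m) partnerᵥ (λ i p → ran-in m i _ (partnerᵥ-edge i p))
     (λ i i' p p' e → col-unique i i' _ (partnerᵥ-edge i p) (subst (λ z → m i' z ≡ true) (sym e) (partnerᵥ-edge i' p'))))
  where
  partnerᵤ : Fin n → Fin n
  partnerᵤ j = choose (λ i → m i j) j
  partnerᵤ-edge : ∀ j → ran m j ≡ true → m (partnerᵤ j) j ≡ true
  partnerᵤ-edge j = choose-spec (λ i → m i j) j
  partnerᵥ : Fin n → Fin n
  partnerᵥ i = choose (m i) i
  partnerᵥ-edge : ∀ i → dom m i ≡ true → m i (partnerᵥ i) ≡ true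
  partnerᵥ-edge i = choose-spec (m i) i

sum-indicator : ∀ {k n} (f : Fin k → Bool) (t : Fin n → Fin k) →
                sum (map (λ i → if f i then 1 else 0) (List.tabulate t)) ≡ count (f ∘ t)
sum-indicator {n = zero} f t = refl
sum-indicator {n = suc n} f t = cong (b2n (f (t zero)) +_) (sum-indicator f (t ∘ suc))

count-subsingleton : ∀ {n} (f : Fin n → Bool) → (∀ j j' → f j ≡ true → f j' ≡ true → j ≡ j') →
                     count f ≡ b2n (anyF f)
count-subsingleton f unique with anyF f in any
... | false = count-zero f (anyF-false f any)
... | true with anyF-sound f any
... | a , fa = trans (count-remove f a fa) (cong suc (count-zero _ only-a))
  where
  only-a : ∀ i → (f i ∧ not (eqb i a)) ≡ false
  only-a i with f i in fi
  ... | false = refl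
  ... | true rewrite unique i a fi fa | eqb-refl a = refl

size-dom : ∀ {n} (G : BipGraph n) (m : EdgeSet n) → IsMatching G m → size m ≡ count (dom m)
size-dom {n} G m (_ , row-unique , _) = begin
    size m
  ≡⟨ cong sum (map-cong row (allFin n)) ⟩
    sum (map (λ i → if dom m i then 1 else 0) (allFin n))
  ≡⟨ sum-indicator (dom m) (λ i → i) ⟩
    count (dom m)
  ∎
  where
  open ≡-Reasoning
  row : ∀ i → sum (map (λ j → if m i j then 1 else 0) (allFin n)) ≡ (if dom m i then 1 else 0)
  row i = trans (sum-indicator (m i) (λ j → j)) (count-subsingleton (m i) (row-unique i))

addEdge : ∀ {n} → EdgeSet n → Fin n → Fin n → EdgeSet n
addEdge m c d a b = m a b ∨ (eqb a c ∧ eqb b d)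

remEdge : ∀ {n} → EdgeSet n → Fin n → Fin n → EdgeSet n
remEdge m c d a b = m a b ∧ not (eqb a c ∧ eqb b d)

addEdge-cases : ∀ {n} (m : EdgeSet n) c d a b → addEdge m c d a b ≡ true → m a b ≡ true ⊎ (a ≡ c × b ≡ d)
addEdge-cases m c d a b p with ∨-true {m a b} p
... | inj₁ q = inj₁ q
... | inj₂ q = inj₂ (eqb-true (proj₁ (∧-true q)) , eqb-true (proj₂ (∧-true q)))

addEdge-new : ∀ {n} (m : EdgeSet n) c d → addEdge m c d c d ≡ true
addEdge-new m c d = ∨-r (m c d) (∧-intro (eqb-refl c) (eqb-refl d))

addEdge-old : ∀ {n} (m : EdgeSet n) c d a b → m a b ≡ true → addEdge m c d a b ≡ true
addEdge-old m c d a b = ∨-l _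

remEdge-sub : ∀ {n} (m : EdgeSet n) c d → remEdge m c d ⊆ₑ m
remEdge-sub m c d a b p = proj₁ (∧-true p)

remEdge-keep : ∀ {n} (m : EdgeSet n) c d a b → m a b ≡ true → ¬ (a ≡ c × b ≡ d) → remEdge m c d a b ≡ true
remEdge-keep m c d a b p ne with a ≟ c | b ≟ d
... | yes refl | yes refl = ⊥-elim (ne (refl , refl))
... | yes refl | no _ rewrite p = refl
... | no _ | _ rewrite p = refl

addEdge-match : ∀ {n} (G : BipGraph n) (m : EdgeSet n) (c d : Fin n) → IsMatching G m →
                G c d ≡ true → dom m c ≡ false → ran m d ≡ false → IsMatching G (addEdge m c d)
addEdge-match G m c d (m⊆G , row-unique , col-unique) gcd domc rand = m′⊆G , row′ , col′
  where
  m′⊆G : addEdge m c d ⊆ₑ G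
  m′⊆G a b p with addEdge-cases m c d a b p
  ... | inj₁ q = m⊆G a b q
  ... | inj₂ (refl , refl) = gcd
  row′ : ∀ i j j' → addEdge m c d i j ≡ true → addEdge m c d i j' ≡ true → j ≡ j'
  row′ i j j' p p' with addEdge-cases m c d i j p | addEdge-cases m c d i j' p'
  ... | inj₁ q | inj₁ q' = row-unique i j j' q q'
  ... | inj₁ q | inj₂ (refl , _) = ⊥-elim (true≢false-at (dom-in m i j q) domc)
  ... | inj₂ (refl , _) | inj₁ q' = ⊥-elim (true≢false-at (dom-in m i j' q') domc)
  ... | inj₂ (_ , refl) | inj₂ (_ , refl) = refl
  col′ : ∀ i i' j → addEdge m c d i j ≡ true → addEdge m c d i' j ≡ true → i ≡ i'
  col′ i i' j p p' with addEdge-cases m c d i j p | addEdge-cases m c d i' j p'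
  ... | inj₁ q | inj₁ q' = col-unique i i' j q q'
  ... | inj₁ q | inj₂ (_ , refl) = ⊥-elim (true≢false-at (ran-in m i j q) rand)
  ... | inj₂ (_ , refl) | inj₁ q' = ⊥-elim (true≢false-at (ran-in m i' j q') rand)
  ... | inj₂ (refl , _) | inj₂ (refl , _) = refl

addEdge-dom : ∀ {n} (m : EdgeSet n) c d a → dom (addEdge m c d) a ≡ (dom m a ∨ eqb a c)
addEdge-dom m c d a = bool-iff to from
  where
  to : dom (addEdge m c d) a ≡ true → (dom m a ∨ eqb a c) ≡ true
  to p with anyF-sound _ p
  ... | b , q with addEdge-cases m c d a b q
  ... | inj₁ r = ∨-l _ (dom-in m a b r)
  ... | inj₂ (refl , _) = ∨-r (dom m a) (eqb-refl a)
  from : (dom m a ∨ eqb a c) ≡ true → dom (addEdge m c d) a ≡ true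
  from p with ∨-true {dom m a} p
  ... | inj₁ q = let (b , r) = anyF-sound _ q in dom-in (addEdge m c d) a b (∨-l _ r)
  ... | inj₂ q with eqb-true q
  ... | refl = dom-in (addEdge m c d) a d (addEdge-new m a d)

addEdge-ran : ∀ {n} (m : EdgeSet n) c d b → ran (addEdge m c d) b ≡ (ran m b ∨ eqb b d)
addEdge-ran m c d b = bool-iff to from
  where
  to : ran (addEdge m c d) b ≡ true → (ran m b ∨ eqb b d) ≡ true
  to p with anyF-sound _ p
  ... | a , q with addEdge-cases m c d a b q
  ... | inj₁ r = ∨-l _ (ran-in m a b r)
  ... | inj₂ (_ , refl) = ∨-r (ran m b) (eqb-refl b)
  from : (ran m b ∨ eqb b d) ≡ true → ran (addEdge m c d) b ≡ true
  from p with ∨-true {ran m b} p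
  ... | inj₁ q = let (a , r) = anyF-sound _ q in ran-in (addEdge m c d) a b (∨-l _ r)
  ... | inj₂ q with eqb-true q
  ... | refl = ran-in (addEdge m c d) c b (addEdge-new m c b)

sub-match : ∀ {n} (G : BipGraph n) (m m′ : EdgeSet n) → IsMatching G m → m′ ⊆ₑ m → IsMatching G m′
sub-match G m m′ (m⊆G , row-unique , col-unique) s =
  (λ a b p → m⊆G a b (s a b p)) ,
  (λ i j j' p q → row-unique i j j' (s _ _ p) (s _ _ q)) ,
  (λ i i' j p q → col-unique i i' j (s _ _ p) (s _ _ q))

noEdges : ∀ {n} → EdgeSet n
noEdges _ _ = false

noEdges-match : ∀ {n} (G : BipGraph n) → IsMatching G noEdges
noEdges-match G = (λ _ _ ()) , (λ _ _ _ ()) , (λ _ _ _ ())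

-- Re-routing u_c from its partner w_d to an uncovered neighbour w_d′: the
-- result is again a matching, covers the same U-vertices, and on the W-side
-- trades d for d′.  This is the elementary step of alternating paths.
module Rematch {n} (G : BipGraph n) (g : EdgeSet n) (g-match : IsMatching G g) (c d d′ : Fin n)
               (gcd : g c d ≡ true) (d′-free : ran g d′ ≡ false) (Gcd′ : G c d′ ≡ true) where
  private
    row-unique = proj₁ (proj₂ g-match)
    col-unique = proj₂ (proj₂ g-match)
    g₁ = remEdge g c d

  rematched : EdgeSet n
  rematched = addEdge g₁ c d′

  keep : ∀ a b → g a b ≡ true → ¬ (a ≡ c × b ≡ d) → rematched a b ≡ true
  keep a b p ne = addEdge-old g₁ c d′ a b (remEdge-keep g c d a b p ne)

  private
    c-free : dom g₁ c ≡ false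
    c-free with dom g₁ c in eq
    ... | false = refl
    ... | true with anyF-sound _ eq
    ... | y , r with ∧-true {g c y} r
    ... | gcy , ne with row-unique c y d gcy gcd
    ... | refl rewrite eqb-refl c | eqb-refl y = ⊥-elim (t≢f (sym ne))

    d′-free₁ : ran g₁ d′ ≡ false
    d′-free₁ with ran g₁ d′ in eq
    ... | false = refl
    ... | true = let (x , r) = anyF-sound _ eq in
                 ⊥-elim (true≢false-at (ran-in g x d′ (remEdge-sub g c d x d′ r)) d′-free)

    ran₁ : ∀ z → ran g₁ z ≡ (ran g z ∧ not (eqb z d))
    ran₁ z = bool-iff to from
      where
      to : ran g₁ z ≡ true → (ran g z ∧ not (eqb z d)) ≡ true
      to r with anyF-sound _ r
      ... | x , s with ∧-true {g x z} s
      ... | gxz , ne = ∧-intro (ran-in g x z gxz) (not-false (eqb-false z≢d))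
        where
        z≢d : z ≢ d
        z≢d refl with col-unique x c z gxz gcd
        ... | refl rewrite eqb-refl x | eqb-refl z = t≢f (sym ne)
      from : (ran g z ∧ not (eqb z d)) ≡ true → ran g₁ z ≡ true
      from r with ∧-true {ran g z} r
      ... | rz , z≢d with anyF-sound _ rz
      ... | x , s = ran-in g₁ x z (remEdge-keep g c d x z s
                      (λ { (_ , refl) → eqb-false⁻ (not-true z≢d) refl }))

  match : IsMatching G rematched
  match = addEdge-match G g₁ c d′ (sub-match G g g₁ g-match (remEdge-sub g c d)) Gcd′ c-free d′-free₁

  dom-eq : ∀ z → dom rematched z ≡ dom g z
  dom-eq z = trans (addEdge-dom g₁ c d′ z) (bool-iff to (from (z ≟ c)))
    where
    to : (dom g₁ z ∨ eqb z c) ≡ true → dom g z ≡ true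
    to r with ∨-true {dom g₁ z} r
    ... | inj₁ r′ = let (y , s) = anyF-sound _ r′ in dom-in g z y (remEdge-sub g c d z y s)
    ... | inj₂ r′ with eqb-true r′
    ... | refl = dom-in g c d gcd
    from : Dec (z ≡ c) → dom g z ≡ true → (dom g₁ z ∨ eqb z c) ≡ true
    from (yes refl) r = ∨-r (dom g₁ z) (eqb-refl z)
    from (no z≢c) r = let (y , s) = anyF-sound _ r in
                      ∨-l _ (dom-in g₁ z y (remEdge-keep g c d z y s (λ { (z≡c , _) → z≢c z≡c })))

  ran-eq : ∀ z → ran rematched z ≡ ((ran g z ∧ not (eqb z d)) ∨ eqb z d′)
  ran-eq z = trans (addEdge-ran g₁ c d′ z) (cong (_∨ eqb z d′) (ran₁ z))

-- Padding with M-edges: if e indices are still uncovered on both sides, the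
-- edges u_c w_c (present since M ⊆ G) enlarge a matching by e edges.
pad : ∀ {n} (G : BipGraph n) → (∀ i → G i i ≡ true) → ∀ e (m₀ : EdgeSet n) → IsMatching G m₀ →
      count (covered m₀) + e ≤ n →
      ∃ λ m → IsMatching G m × (m₀ ⊆ₑ m) × count (dom m) ≡ count (dom m₀) + e
pad G diag zero m₀ m₀-match le = m₀ , m₀-match , (λ i j p → p) , sym (+-identityʳ _)
pad {n} G diag (suc e) m₀ m₀-match le
  with count-missing (covered m₀) (≤-trans (s≤s (m≤m+n _ e)) (subst (_≤ n) (+-suc _ e) le))
... | c , c-free
  with pad G diag e (addEdge m₀ c c) (addEdge-match G m₀ c c m₀-match (diag c) (∨-false-l c-free) (∨-false-r c-free)) le′
  where
  covered-grows : count (covered (addEdge m₀ c c)) ≡ suc (count (covered m₀))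
  covered-grows = trans (count-ext _ _ (λ a → trans (cong₂ _∨_ (addEdge-dom m₀ c c a) (addEdge-ran m₀ c c a))
                                                    (∨-absorb-c (dom m₀ a) (ran m₀ a) (eqb a c))))
                        (count-insert (covered m₀) c c-free)
    where
    ∨-absorb-c : ∀ a b c → ((a ∨ c) ∨ (b ∨ c)) ≡ ((a ∨ b) ∨ c)
    ∨-absorb-c true b c = refl
    ∨-absorb-c false true true = refl
    ∨-absorb-c false true false = refl
    ∨-absorb-c false false true = refl
    ∨-absorb-c false false false = refl
  le′ : count (covered (addEdge m₀ c c)) + e ≤ n
  le′ = subst (_≤ n) (trans (+-suc (count (covered m₀)) e) (cong (_+ e) (sym covered-grows))) le
... | m , m-match , m₀⊆m , size-m = m , m-match , (λ i j p → m₀⊆m i j (∨-l _ p)) ,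
  trans size-m (trans (cong (_+ e) dom-grows) (sym (+-suc _ e)))
  where
  dom-grows : count (dom (addEdge m₀ c c)) ≡ suc (count (dom m₀))
  dom-grows = trans (count-ext _ _ (addEdge-dom m₀ c c)) (count-insert (dom m₀) c (∨-false-l c-free))

extendable-bound : ∀ k n → 2 * k + 1 ≤ 2 * n → k + 1 ≤ n
extendable-bound k n le with k <? n
... | yes lt = subst (_≤ n) (+-comm 1 k) lt
... | no k≮n = ⊥-elim (<⇒≱ (subst (_≤ 2 * n) (+-comm (2 * k) 1) le) (*-monoʳ-≤ 2 (≮⇒≥ k≮n)))

covered-bound : ∀ {n} (m : EdgeSet n) r → (∀ z → ran m z ≡ true → (dom m z ∨ eqb z r) ≡ true) →
                count (covered m) ≤ count (dom m) + 1
covered-bound m r ran⊆ = begin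
    count (covered m)
  ≤⟨ count-mono (covered m) (λ z → dom m z ∨ eqb z r) within ⟩
    count (λ z → dom m z ∨ eqb z r)
  ≤⟨ count-∪ (dom m) (λ z → eqb z r) ⟩
    count (dom m) + count (λ z → eqb z r)
  ≡⟨ cong (count (dom m) +_) (count-singleton r) ⟩
    count (dom m) + 1
  ∎
  where
  open ≤-Reasoning
  within : ∀ z → covered m z ≡ true → (dom m z ∨ eqb z r) ≡ true
  within z q with ∨-true {dom m z} q
  ... | inj₁ in-dom = ∨-l (eqb z r) in-dom
  ... | inj₂ in-ran = ran⊆ z in-ran

-- A matching m with at most k edges whose W-vertices are indexed by dom m
-- and at most one further index r extends to a perfect matching in a
-- k-extendable graph: pad it with M-edges up to exactly k edges (there is
-- room as k < n).
extend-small : ∀ {n} k (G : BipGraph n) → (∀ i → G i i ≡ true) → Extendable k G →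
               (m : EdgeSet n) → IsMatching G m → count (dom m) ≤ k →
               ∀ r → (∀ z → ran m z ≡ true → (dom m z ∨ eqb z r) ≡ true) →
               ∃ λ p → IsPerfectMatching G p × (m ⊆ₑ p)
extend-small {n} k G diag (_ , k-bound , _ , extends) m m-match small r ran⊆
  with pad G diag (k ∸ count (dom m)) m m-match room
  where
  room : count (covered m) + (k ∸ count (dom m)) ≤ n
  room = ≤-trans (+-monoˡ-≤ (k ∸ count (dom m)) (covered-bound m r ran⊆))
           (subst (_≤ n) (trans (cong (_+ 1) (sym (m+[n∸m]≡n small))) (reassoc (count (dom m)) _))
                  (extendable-bound k n k-bound))
    where
    reassoc : ∀ a b → (a + b) + 1 ≡ (a + 1) + b
    reassoc = solve-∀
... | m′ , m′-match , m⊆m′ , size-m′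
  with extends m′ m′-match (trans (size-dom G m′ m′-match) (trans size-m′ (m+[n∸m]≡n small)))
... | p , p-perfect , m′⊆p = p , p-perfect , λ i j e → m′⊆p i j (m⊆m′ i j e)

-- A perfect matching is a bijection, so it cannot map a set P of U-indices
-- into P with one index r removed.
perfect-no-shrink : ∀ {n} (G : BipGraph n) (p : EdgeSet n) → IsPerfectMatching G p →
                    (P : Fin n → Bool) (r : Fin n) → P r ≡ true →
                    (∀ i j → P i ≡ true → p i j ≡ true → (P j ∧ not (eqb j r)) ≡ true) → ⊥
perfect-no-shrink G p ((_ , _ , col-unique) , rows , _) P r Pr into =
  pigeonhole P r Pr partner (λ i Pi → into i (partner i) Pi (partner-edge i)) injective
  where
  partner : _ → _
  partner i = proj₁ (rows i)
  partner-edge : ∀ i → p i (partner i) ≡ true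
  partner-edge i = proj₂ (rows i)
  injective : ∀ i j → P i ≡ true → P j ≡ true → partner i ≡ partner j → i ≡ j
  injective i j _ _ e = col-unique i j (partner i) (partner-edge i)
                          (subst (λ z → p j z ≡ true) (sym e) (partner-edge j))

D-edge : ∀ {n} (G : BipGraph n) i j → D G i j ≡ true → G i j ≡ true
D-edge G i j p = proj₂ (∧-true {not (eqb i j)} p)

D-distinct : ∀ {n} (G : BipGraph n) i j → D G i j ≡ true → i ≢ j
D-distinct G i j p refl with ∧-true {not (eqb i i)} p
... | q , _ rewrite eqb-refl i = t≢f (sym q)

D-arc : ∀ {n} (G : BipGraph n) i j → i ≢ j → G i j ≡ true → D G i j ≡ true
D-arc G i j ne p rewrite eqb-false ne | p = refl

member : ∀ {n} → Subset n → Fin n → Bool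
member S i = lookup S i

∉-false : ∀ {n} (S : Subset n) x → x ∉ S → member S x ≡ false
∉-false S x x∉S with lookup S x in eq
... | false = refl
... | true = ⊥-elim (x∉S (lookup⇒[]= x S eq))

false-∉ : ∀ {n} (S : Subset n) x → member S x ≡ false → x ∉ S
false-∉ S x p x∈S = true≢false-at ([]=⇒lookup x∈S) p

card-count : ∀ {n} (S : Subset n) → ∣ S ∣ ≡ count (member S)
card-count [] = refl
card-count (true ∷ S) = cong suc (card-count S)
card-count (false ∷ S) = card-count S

toSubset : ∀ {n} → (Fin n → Bool) → Subset n
toSubset f = tabulate f

toSubset-member : ∀ {n} (f : Fin n → Bool) i → member (toSubset f) i ≡ f i
toSubset-member f i = lookup∘tabulate f i

card-toSubset : ∀ {n} (f : Fin n → Bool) → ∣ toSubset f ∣ ≡ count f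
card-toSubset f = trans (card-count (toSubset f)) (count-ext _ _ (toSubset-member f))

closed-separator : ∀ {n} (A : Digraph n) (S : Subset n) (C : Fin n → Bool) x y →
                   x ∉ S → y ∉ S → C x ≡ true → C y ≡ false →
                   (∀ i j → C i ≡ true → ArcOutside A S i j → C j ≡ true) → IsSeparator A S
closed-separator A S C x y x∉S y∉S Cx Cy closed strong =
  true≢false-at (star-closed (ArcOutside A S) C closed (strong x y x∉S y∉S x≢y) Cx) Cy
  where
  x≢y : x ≢ y
  x≢y refl = true≢false-at Cx Cy

-- (T2), main step: if D(G,M) is k-strong, every matching m with k edges
-- extends to a perfect matching.  Starting from g = m we repeatedly cover one
-- more U-vertex u_a by an alternating path that never uses the W-vertices
-- covered by m (so m stays inside g).  If no such path exists, the U-indices I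
-- reachable from a by alternating paths give a separator of D of size < k.
module Augmentation {n} (k : ℕ) (G : BipGraph n) (diag : ∀ i → G i i ≡ true) (strong : KStrong k (D G))
                    (m : EdgeSet n) (m-match : IsMatching G m) (size-m : count (dom m) ≡ k) where

  Extends : EdgeSet n → Set
  Extends g = IsMatching G g × (m ⊆ₑ g)

  -- Alternating step from u_i: a non-m edge u_i w_j followed by the g-edge w_j u_c.
  Alt : EdgeSet n → Fin n → Fin n → Bool
  Alt g i c = anyF (λ j → G i j ∧ (not (ran m j) ∧ g c j))

  Reach : EdgeSet n → Fin n → ℕ → Fin n → Bool
  Reach g a t = iter (Alt g) t (λ i → eqb i a)

  Grown : Fin n → EdgeSet n → Set
  Grown a g = ∃ λ g′ → Extends g′ × (∀ z → dom g′ z ≡ (dom g z ∨ eqb z a))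

  -- Induction on the path length: re-route its last vertex u_i to w_j.
  augment : ∀ a t g → Extends g → dom g a ≡ false → ∀ i j → Reach g a t i ≡ true →
            G i j ≡ true → ran m j ≡ false → ran g j ≡ false → Grown a g
  augment a zero g (g-match , m⊆g) a-free i j i≡a Gij m-free g-free with eqb-true i≡a
  ... | refl = addEdge g a j , (addEdge-match G g a j g-match Gij a-free g-free , λ x y e → addEdge-old g a j x y (m⊆g x y e)) ,
               addEdge-dom g a j
  augment a (suc t) g ext a-free i j reach Gij m-free g-free with step-cases (Alt g) _ i reach
  ... | inj₁ earlier = augment a t g ext a-free i j earlier Gij m-free g-free
  ... | inj₂ (i-new , i′ , reach′ , alt) with anyF-sound _ alt
  ... | j′ , w = shifted
    where
    Gi′j′ : G i′ j′ ≡ true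
    Gi′j′ = proj₁ (∧-true w)
    j′-m-free : ran m j′ ≡ false
    j′-m-free = not-true (proj₁ (∧-true (proj₂ (∧-true {G i′ j′} w))))
    gij′ : g i j′ ≡ true
    gij′ = proj₂ (∧-true (proj₂ (∧-true {G i′ j′} w)))
    j≢j′ : j ≢ j′
    j≢j′ refl = true≢false-at (ran-in g i j gij′) g-free
    open Rematch G g (proj₁ ext) i j′ j gij′ g-free Gij
    ext′ : Extends rematched
    ext′ = match , λ x y e → keep x y (proj₂ ext x y e) (λ { (refl , refl) → true≢false-at (ran-in m x y e) j′-m-free })
    j′-free : ran rematched j′ ≡ false
    j′-free rewrite ran-eq j′ | eqb-refl j′ | eqb-false (λ e → j≢j′ (sym e)) | ∧-zeroʳ (ran g j′) = refl
    reach-kept : Reach rematched a t i′ ≡ true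
    reach-kept = iter-transfer (Alt g) (Alt rematched) _ i same t i-new i′ reach′
      where
      same : ∀ x z → Alt g x z ≡ true → z ≢ i → Alt rematched x z ≡ true
      same x z e z≢i with anyF-sound _ e
      ... | y , s with ∧-true {G x y} s
      ... | Gxy , s′ with ∧-true {not (ran m y)} s′
      ... | y-m-free , gzy = anyF-complete _ y (∧-intro Gxy (∧-intro y-m-free
                               (keep z y gzy (λ { (z≡i , _) → z≢i z≡i }))))
    shifted : Grown a g
    shifted with augment a t rematched ext′ (trans (dom-eq a) a-free) i′ j′ reach-kept Gi′j′ j′-m-free j′-free
    ... | g′ , ext″ , dom-g′ = g′ , ext″ , λ z → trans (dom-g′ z) (cong (_∨ eqb z a) (dom-eq z))

  -- When no alternating path from u_a reaches a W-vertex free for m and g,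
  -- let I be the U-indices reachable from a, J the W-neighbours of I not
  -- covered by m, and S = (ran m ∪ J) ∖ I.  Then D - S has no arc leaving I,
  -- while |S| < k and I ∪ S is not everything: S is a small separator.
  module Obstruction (g : EdgeSet n) (ext : Extends g) (a : Fin n) (a-free : dom g a ≡ false)
                     (stuck : ∀ i j → Reach g a (suc n) i ≡ true →
                              G i j ≡ true → ran m j ≡ false → ran g j ≡ true) where
    private
      row-unique = proj₁ (proj₂ (proj₁ ext))

    I : Fin n → Bool
    I = Reach g a (suc n)

    J : Fin n → Bool
    J b = anyF (λ i → I i ∧ (G i b ∧ not (ran m b)))

    N : Fin n → Bool
    N b = ran m b ∨ J b

    S : Fin n → Bool
    S b = not (I b) ∧ N b

    a∈I : I a ≡ true
    a∈I = closure-base (Alt g) _ a (eqb-refl a)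

    J-intro : ∀ i b → I i ≡ true → G i b ≡ true → ran m b ≡ false → J b ≡ true
    J-intro i b Ii Gib b-free = anyF-complete _ i (∧-intro Ii (∧-intro Gib (not-false b-free)))

    N-intro : ∀ i b → I i ≡ true → G i b ≡ true → N b ≡ true
    N-intro i b Ii Gib with inspect-bool (ran m b)
    ... | inj₁ covered = ∨-l (J b) covered
    ... | inj₂ b-free = ∨-r (ran m b) (J-intro i b Ii Gib b-free)

    -- Edges from I lead into N; hence outside S they lead back into I.
    I-closed : ∀ i z → I i ≡ true → G i z ≡ true → S z ≡ false → I z ≡ true
    I-closed i z Ii Giz Sz with I z in eq
    ... | true = refl
    ... | false = ⊥-elim (true≢false-at (N-intro i z Ii Giz) Sz)

    -- I ⊆ N, because of the M-edges u_b w_b.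
    I⊆N : ∀ b → I b ≡ true → N b ≡ true
    I⊆N b Ib = N-intro b b Ib (diag b)

    partner : Fin n → Fin n
    partner b = choose (λ c → g c b) b

    partner-spec : ∀ b → J b ≡ true → g (partner b) b ≡ true × I (partner b) ≡ true
    partner-spec b Jb with anyF-sound _ Jb
    ... | i , q with ∧-true q
    ... | Ii , q′ with ∧-true {G i b} q′
    ... | Gib , b-free = matched , closure-closed (Alt g) _ i (partner b) Ii
                                     (anyF-complete _ b (∧-intro Gib (∧-intro b-free matched)))
      where
      matched : g (partner b) b ≡ true
      matched = choose-spec (λ c → g c b) b (stuck i b Ii Gib (not-true b-free))

    J-small : suc (count J) ≤ count I
    J-small = subst (suc (count J) ≤_) (sym (count-remove I a a∈I)) (s≤s (inj-count J _ partner into injective))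
      where
      into : ∀ b → J b ≡ true → (I (partner b) ∧ not (eqb (partner b) a)) ≡ true
      into b Jb with partner-spec b Jb
      ... | gpb , Ipb = ∧-intro Ipb (not-false (eqb-false λ e →
                          true≢false-at (dom-in g (partner b) b gpb) (subst (λ z → dom g z ≡ false) (sym e) a-free)))
      injective : ∀ b b′ → J b ≡ true → J b′ ≡ true → partner b ≡ partner b′ → b ≡ b′
      injective b b′ Jb Jb′ e = row-unique (partner b) b b′ (proj₁ (partner-spec b Jb))
                                  (subst (λ c → g c b′ ≡ true) (sym e) (proj₁ (partner-spec b′ Jb′)))

    -- |S| + |I| = |N| ≤ |ran m| + |J| = k + |J| < k + |I|.
    S-small : suc (count S) ≤ k
    S-small = +-cancelʳ-≤ (count J) (suc (count S)) k
                (≤-trans (≤-reflexive (sym (+-suc (count S) (count J))))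
                  (≤-trans (+-monoʳ-≤ (count S) J-small) S+I≤k+J))
      where
      S+I≤k+J : count S + count I ≤ k + count J
      S+I≤k+J = begin
          count S + count I
        ≡⟨ +-comm (count S) (count I) ⟩
          count I + count S
        ≡⟨ cong₂ _+_ (count-ext _ _ (λ b → sym (∧-absorb (N b) (I b) (I⊆N b))))
                     (count-ext _ _ (λ b → ∧-comm (not (I b)) (N b))) ⟩
          count (λ b → N b ∧ I b) + count (λ b → N b ∧ not (I b))
        ≡⟨ sym (count-split N I) ⟩
          count N
        ≤⟨ count-∪ (ran m) J ⟩
          count (ran m) + count J
        ≡⟨ cong (_+ count J) (trans (ran-count G m m-match) size-m) ⟩
          k + count J
        ∎
        where
        open ≤-Reasoning
        ∧-absorb : ∀ (x y : Bool) → (y ≡ true → x ≡ true) → (x ∧ y) ≡ y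
        ∧-absorb x false _ = ∧-zeroʳ x
        ∧-absorb x true h rewrite h refl = refl

    -- I avoids the U-vertices of m: alternating steps end at g-partners of
    -- W-vertices outside ran m, and m ⊆ g.
    I-avoids-m : ∀ z → I z ≡ true → dom m z ≡ false
    I-avoids-m = closure-all (Alt g) _ _ start step-end
      where
      m⊆g = proj₂ ext
      start : ∀ z → eqb z a ≡ true → dom m z ≡ false
      start z p with eqb-true p | dom m z in eq
      ... | refl | false = refl
      ... | refl | true = let (y , r) = anyF-sound _ eq in
                          ⊥-elim (true≢false-at (dom-in g z y (m⊆g z y r)) a-free)
      step-end : ∀ x z → Alt g x z ≡ true → dom m z ≡ false
      step-end x z e with anyF-sound _ e
      ... | y , w with ∧-true (proj₂ (∧-true {G x y} w))
      ... | y-m-free , gzy with dom m z in eq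
      ... | false = refl
      ... | true with anyF-sound _ eq
      ... | y₀ , mzy₀ with row-unique z y₀ y (m⊆g z y₀ mzy₀) gzy
      ... | refl = ⊥-elim (true≢false-at (ran-in m z y₀ mzy₀) (not-true y-m-free))

    I-room : count I + k ≤ n
    I-room = begin
        count I + k
      ≤⟨ +-mono-≤ (count-mono I (λ z → not (dom m z)) (λ z p → not-false (I-avoids-m z p))) (≤-reflexive (sym size-m)) ⟩
        count (λ z → not (dom m z)) + count (dom m)
      ≡⟨ trans (+-comm _ (count (dom m))) (count-compl (dom m)) ⟩
        n
      ∎
      where open ≤-Reasoning

    outside : ∃ λ y → (I y ∨ S y) ≡ false
    outside = count-missing (λ b → I b ∨ S b)
                (≤-trans (s≤s (count-∪ I S))
                  (≤-trans (≤-reflexive (sym (+-suc (count I) (count S))))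
                    (≤-trans (+-monoʳ-≤ (count I) S-small) I-room)))

    S-separates : IsSeparator (D G) (toSubset S)
    S-separates with outside
    ... | y , y-out = closed-separator (D G) (toSubset S) I a y
                        (not-in a (cong (λ b → not b ∧ N a) a∈I)) (not-in y (∨-false-r {I y} y-out))
                        a∈I (∨-false-l y-out)
                        (λ i z Ii (_ , z∉S , arc) → I-closed i z Ii (D-edge G i z arc)
                                                      (trans (sym (toSubset-member S z)) (∉-false _ z z∉S)))
      where
      not-in : ∀ b → S b ≡ false → b ∉ toSubset S
      not-in b Sb = false-∉ (toSubset S) b (trans (toSubset-member S b) Sb)

    impossible : ⊥
    impossible = <⇒≱ S-small (subst (k ≤_) (card-toSubset S) (proj₂ strong (toSubset S) S-separates))

  grow : ∀ g → Extends g → ∀ a → dom g a ≡ false → Grown a g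
  grow g ext a a-free with anyF (λ i → Reach g a (suc n) i ∧ free i) in any
    where
    free : Fin n → Bool
    free i = anyF (λ j → G i j ∧ (not (ran m j) ∧ not (ran g j)))
  ... | true with anyF-sound _ any
  ... | i , p with ∧-true p
  ... | Ii , fi with anyF-sound _ fi
  ... | j , q with ∧-true {G i j} q
  ... | Gij , q′ with ∧-true {not (ran m j)} q′
  ... | m-free , g-free = augment a (suc n) g ext a-free i j Ii Gij (not-true m-free) (not-true g-free)
  grow g ext a a-free | false = ⊥-elim (Obstruction.impossible g ext a a-free stuck)
    where
    stuck : ∀ i j → Reach g a (suc n) i ≡ true → G i j ≡ true → ran m j ≡ false → ran g j ≡ true
    stuck i j Ii Gij m-free with ran g j in eq
    ... | true = refl
    ... | false = ⊥-elim (true≢false-at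
                    (anyF-complete _ i (∧-intro Ii (anyF-complete _ j (∧-intro Gij (∧-intro (not-false m-free) (not-false eq))))))
                    any)

  -- A matching covering all of U is perfect (it covers equally many W-vertices).
  perfect : ∀ g → Extends g → (∀ i → dom g i ≡ true) → ∃ λ p → IsPerfectMatching G p × (m ⊆ₑ p)
  perfect g (g-match , m⊆g) all-covered = g , (g-match , (λ i → anyF-sound _ (all-covered i)) , cols) , m⊆g
    where
    cols : ∀ j → ∃ λ i → g i j ≡ true
    cols j = anyF-sound _ (count-full (ran g)
               (≤-reflexive (sym (trans (ran-count G g g-match) (trans (count-ext _ _ all-covered) count-full-set)))) j)

  -- Grow m one U-vertex at a time; at most n steps are needed.
  extend : ∃ λ p → IsPerfectMatching G p × (m ⊆ₑ p)
  extend = go n m (m-match , λ i j p → p) (m≤m+n n _)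
    where
    go : ∀ fuel g → Extends g → n ≤ fuel + count (dom g) → ∃ λ p → IsPerfectMatching G p × (m ⊆ₑ p)
    go zero g ext le = perfect g ext (count-full (dom g) le)
    go (suc fuel) g ext le with anyF (λ i → not (dom g i)) in any
    ... | false = perfect g ext (λ i → not-false⁻ (anyF-false _ any i))
      where
      not-false⁻ : ∀ {b} → not b ≡ false → b ≡ true
      not-false⁻ {true} _ = refl
    ... | true with anyF-sound _ any
    ... | a , a-free with grow g ext a (not-true a-free)
    ... | g′ , ext′ , dom-g′ = go fuel g′ ext′ (subst (n ≤_) (trans (sym (+-suc fuel _)) (cong (fuel +_) (sym grown))) le)
      where
      grown : count (dom g′) ≡ suc (count (dom g))
      grown = trans (count-ext _ _ dom-g′) (count-insert (dom g) a (not-true a-free))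

-- For k ≥ 1 the empty set is no separator, so D itself is strong.
strong-paths : ∀ {n} k → 1 ≤ k → (A : Digraph n) → KStrong k A → ∀ x y → Star (ArcOutside A Subset.⊥) x y
strong-paths {n} k k≥1 A strong x y with inspect-bool (closure A (λ i → eqb i x) y)
... | inj₁ reached = closure-path _ A x (λ i j arc → ∉⊥ , ∉⊥ , arc) y reached
... | inj₂ unreached = ⊥-elim (<⇒≱ k≥1 (subst (k ≤_) (∣⊥∣≡0 n) (proj₂ strong Subset.⊥ empty-separates)))
  where
  empty-separates : IsSeparator A Subset.⊥
  empty-separates = closed-separator A Subset.⊥ (closure A (λ i → eqb i x)) x y ∉⊥ ∉⊥
                      (closure-base A _ x (eqb-refl x)) unreached
                      (λ i j Ri (_ , _ , arc) → closure-closed A _ i j Ri arc)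

-- An arc v_i → v_j of D(G,M) - S gives the walk u_i w_j u_j in G.
walk-of-path : ∀ {n} (G : BipGraph n) → (∀ i → G i i ≡ true) → ∀ (S : Subset n) {x y} →
               Star (ArcOutside (D G) S) x y → Star (Adj G) (inj₁ x) (inj₁ y)
walk-of-path G diag S ε = ε
walk-of-path G diag S {x} (_◅_ {j = j} (_ , _ , arc) path) =
  _◅_ {j = inj₂ j} (D-edge G x j arc) (_◅_ {j = inj₁ j} (diag j) (walk-of-path G diag S path))

strong⇒connected : ∀ {n} k → 1 ≤ k → (G : BipGraph n) → (∀ i → G i i ≡ true) → KStrong k (D G) → Connected G
strong⇒connected k k≥1 G diag strong = connect
  where
  walk : ∀ x y → Star (Adj G) (inj₁ x) (inj₁ y)
  walk x y = walk-of-path G diag Subset.⊥ (strong-paths k k≥1 (D G) strong x y)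
  from-w : ∀ x → Star (Adj G) (inj₂ x) (inj₁ x)
  from-w x = _◅_ {j = inj₁ x} (diag x) ε
  to-w : ∀ y → Star (Adj G) (inj₁ y) (inj₂ y)
  to-w y = _◅_ {j = inj₂ y} (diag y) ε
  connect : Connected G
  connect (inj₁ x) (inj₁ y) = walk x y
  connect (inj₁ x) (inj₂ y) = walk x y ◅◅ to-w y
  connect (inj₂ x) (inj₁ y) = from-w x ◅◅ walk x y
  connect (inj₂ x) (inj₂ y) = from-w x ◅◅ walk x y ◅◅ to-w y

-- k < n M-edges form a matching of size k.
matching-of-size : ∀ {n} k (G : BipGraph n) → (∀ i → G i i ≡ true) → k + 1 ≤ n →
                   ∃ λ m → IsMatching G m × size m ≡ k
matching-of-size {n} k G diag k<n with pad G diag k (noEdges {n}) (noEdges-match G) room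
  where
  room : count (covered (noEdges {n})) + k ≤ n
  room = subst (λ c → c + k ≤ n) (sym (count-zero {n} _ (λ i → cong₂ _∨_ (anyF-empty {n}) (anyF-empty {n}))))
           (≤-trans (n≤1+n k) (subst (_≤ n) (+-comm k 1) k<n))
... | m , m-match , _ , size-m = m , m-match ,
  trans (size-dom G m m-match) (trans size-m (cong (_+ k) (count-zero {n} _ (λ i → anyF-empty {n}))))

strong⇒extendable : ∀ {n} k → 1 ≤ k → (G : BipGraph n) → (∀ i → G i i ≡ true) → KStrong k (D G) → Extendable k G
strong⇒extendable {n} k k≥1 G diag strong =
  strong⇒connected k k≥1 G diag strong ,
  double-bound ,
  matching-of-size k G diag (proj₁ strong) ,
  λ m m-match size-m → Augmentation.extend k G diag strong m m-match (trans (sym (size-dom G m m-match)) size-m)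
  where
  double-bound : 2 * k + 1 ≤ 2 * n
  double-bound = ≤-trans (n≤1+n _) (subst (_≤ 2 * n) (double k) (*-monoʳ-≤ 2 (proj₁ strong)))
    where
    double : ∀ k → 2 * (k + 1) ≡ suc (2 * k + 1)
    double = solve-∀

perfect-partner : ∀ {n} (G : BipGraph n) (m p : EdgeSet n) → IsPerfectMatching G p → m ⊆ₑ p →
                  ∀ i j → p i j ≡ true → ran m j ≡ true → dom m i ≡ true
perfect-partner G m p ((_ , _ , col-unique) , _) m⊆p i j pij covered with anyF-sound _ covered
... | i′ , mi′j with col-unique i i′ j pij (m⊆p i′ j mi′j)
... | refl = dom-in m i j mi′j

BackClosed : ∀ {n} → BipGraph n → (Fin n → Bool) → Set
BackClosed G C = ∀ z v → D G z v ≡ true → C v ≡ true → C z ≡ true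

-- In a k-extendable graph (k ≥ 1) no G-edge u_q w_q′ leaves a back-closed
-- set C: a perfect matching p through u_q w_q′ would map the complement of C
-- into itself minus q′.
back-closed-no-exit : ∀ {n} k → 1 ≤ k → (G : BipGraph n) → (∀ i → G i i ≡ true) → Extendable k G →
                      (C : Fin n → Bool) → BackClosed G C →
                      ∀ q q′ → G q q′ ≡ true → C q ≡ true → C q′ ≡ false → ⊥
back-closed-no-exit {n} k k≥1 G diag ext C closed q q′ Gqq′ Cq Cq′ =
  no-perfect (extend-small k G diag ext m₁ m₁-match (≤-trans (≤-reflexive size₁) k≥1)
                q′ (λ z e → ∨-r (dom m₁ z) (trans (sym (ran₁ z)) e)))
  where
  m₁ : EdgeSet n
  m₁ = addEdge noEdges q q′
  m₁-match : IsMatching G m₁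
  m₁-match = addEdge-match G noEdges q q′ (noEdges-match G) Gqq′ (anyF-empty {n}) (anyF-empty {n})
  dom₁ : ∀ z → dom m₁ z ≡ eqb z q
  dom₁ z = trans (addEdge-dom noEdges q q′ z) (cong (_∨ eqb z q) (anyF-empty {n}))
  ran₁ : ∀ z → ran m₁ z ≡ eqb z q′
  ran₁ z = trans (addEdge-ran noEdges q q′ z) (cong (_∨ eqb z q′) (anyF-empty {n}))
  size₁ : count (dom m₁) ≡ 1
  size₁ = trans (count-ext _ _ dom₁) (count-singleton q)
  no-perfect : (∃ λ p → IsPerfectMatching G p × (m₁ ⊆ₑ p)) → ⊥
  no-perfect (p , p-perfect , m₁⊆p) = perfect-no-shrink G p p-perfect (λ z → not (C z)) q′ (cong not Cq′) into
    where
    into : ∀ i j → not (C i) ≡ true → p i j ≡ true → (not (C j) ∧ not (eqb j q′)) ≡ true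
    into i j i∉C pij = ∧-intro (not-false Cj) (not-false (eqb-false j≢q′))
      where
      j≢q′ : j ≢ q′
      j≢q′ refl with eqb-true (trans (sym (dom₁ i)) (perfect-partner G m₁ p p-perfect m₁⊆p i j pij (trans (ran₁ j) (eqb-refl j))))
      ... | refl = true≢false-at Cq (not-true i∉C)
      Cj : C j ≡ false
      Cj with C j in eq | i ≟ j
      ... | false | _ = refl
      ... | true | yes refl = ⊥-elim (true≢false-at eq (not-true i∉C))
      ... | true | no i≢j = ⊥-elim (true≢false-at (closed i j (D-arc G i j i≢j (proj₁ (proj₁ p-perfect) i j pij)) eq) (not-true i∉C))

-- Hence a back-closed set containing x but not y cannot exist: a walk in G
-- from u_x to u_y would have to leave it along such an edge (an edge w_j u_i
-- leaving it would be an arc v_i → v_j entering it).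
back-closed-trivial : ∀ {n} k → 1 ≤ k → (G : BipGraph n) → (∀ i → G i i ≡ true) → Extendable k G →
                      (C : Fin n → Bool) → BackClosed G C → ∀ x y → C x ≡ true → C y ≡ false → ⊥
back-closed-trivial k k≥1 G diag ext C closed x y Cx Cy = leaves (proj₁ ext (inj₁ x) (inj₁ y)) Cx Cy
  where
  side : ∀ {n} → Vtx n → Fin n
  side (inj₁ i) = i
  side (inj₂ j) = j
  exit : ∀ a b → Adj G a b → C (side a) ≡ true → C (side b) ≡ false → ⊥
  exit (inj₁ i) (inj₂ j) Gij Ci Cj = back-closed-no-exit k k≥1 G diag ext C closed i j Gij Ci Cj
  exit (inj₂ j) (inj₁ i) Gij Cj Ci with i ≟ j
  ... | yes refl = true≢false-at Cj Ci
  ... | no i≢j = true≢false-at (closed i j (D-arc G i j i≢j Gij) Cj) Ci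
  leaves : ∀ {a b} → Star (Adj G) a b → C (side a) ≡ true → C (side b) ≡ false → ⊥
  leaves ε Ca Cb = true≢false-at Ca Cb
  leaves (_◅_ {i = a} {j = a′} e walk) Ca Cb with inspect-bool (C (side a′))
  ... | inj₁ Ca′ = leaves walk Ca′ Cb
  ... | inj₂ Ca′ = exit a a′ e Ca Ca′

-- Let S be a set of fewer than k indices and R a set
-- disjoint from S that is closed under the arcs of D - S.  Let B be the set
-- of vertices from which R can be reached by a path whose other vertices lie
-- in S.  For each v ∈ B there is a matching of size |S| that covers the
-- U-vertices of S and the W-vertices of S ∪ {r} ∖ {v} for some r ∈ R; an
-- arc t → v from a vertex t ∉ R ∪ S would extend it to a matching of size
-- ≤ k whose perfect extension maps R into R ∖ {r}.  So B is back-closed.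
module Rerouting {n} (k : ℕ) (G : BipGraph n) (diag : ∀ i → G i i ≡ true) (ext : Extendable k G)
                 (S : Fin n → Bool) (S-small : suc (count S) ≤ k)
                 (R : Fin n → Bool) (R∩S : ∀ i → R i ≡ true → S i ≡ false)
                 (R-closed : ∀ i j → R i ≡ true → D G i j ≡ true → S j ≡ false → R j ≡ true) where

  Back : Fin n → Fin n → Bool
  Back i s = S s ∧ D G s i

  B : Fin n → Bool
  B = closure Back R

  -- The matching attached to v ∈ iter Back t R.  It uses the M-edge u_s w_s
  -- for every s ∈ S not yet reached after t backward steps.
  record Chain (t : ℕ) (v : Fin n) : Set where
    field
      matching   : EdgeSet n
      is-match   : IsMatching G matching
      dom-S      : ∀ i → dom matching i ≡ S i
      v-free     : ran matching v ≡ false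
      root       : Fin n
      root∈R     : R root ≡ true
      ran-S      : ∀ z → (ran matching z ∨ eqb z v) ≡ (S z ∨ eqb z root)
      unreached  : ∀ s → S s ≡ true → iter Back t R s ≡ false → matching s s ≡ true

  -- For v ∈ R: the M-edges of S, with root v.
  chain-base : ∀ v → R v ≡ true → Chain zero v
  chain-base v Rv = record
    { matching = m₀ ; is-match = m₀-match ; dom-S = dom₀ ; v-free = trans (ran₀ v) (R∩S v Rv)
    ; root = v ; root∈R = Rv ; ran-S = λ z → cong (_∨ eqb z v) (ran₀ z)
    ; unreached = λ s Ss _ → ∧-intro Ss (eqb-refl s) }
    where
    m₀ : EdgeSet n
    m₀ a b = S a ∧ eqb a b
    diagonal : ∀ {a b} → m₀ a b ≡ true → a ≡ b
    diagonal {a} p = eqb-true (proj₂ (∧-true {S a} p))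
    m₀-match : IsMatching G m₀
    m₀-match = (λ a b p → subst (λ z → G a z ≡ true) (diagonal p) (diag a)) ,
               (λ i j j′ p q → trans (sym (diagonal p)) (diagonal q)) ,
               (λ i i′ j p q → trans (diagonal p) (sym (diagonal q)))
    dom₀ : ∀ i → dom m₀ i ≡ S i
    dom₀ i = bool-iff (λ p → proj₁ (∧-true {S i} (proj₂ (anyF-sound (m₀ i) p))))
                      (λ Si → dom-in m₀ i i (∧-intro Si (eqb-refl i)))
    ran₀ : ∀ i → ran m₀ i ≡ S i
    ran₀ i = bool-iff (λ p → let (b , q) = anyF-sound (λ b → m₀ b i) p in
                             subst (λ z → S z ≡ true) (diagonal q) (proj₁ (∧-true q)))
                      (λ Si → ran-in m₀ i i (∧-intro Si (eqb-refl i)))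

  -- Stepping back along s → u (s ∈ S): re-route u_s from w_s to w_u.
  chain-step : ∀ t s u → iter Back t R s ≡ false → iter Back (suc t) R s ≡ true →
               S s ≡ true → D G s u ≡ true → Chain t u → Chain (suc t) s
  chain-step t s u s-new reached Ss arc c = record
    { matching = rematched ; is-match = match ; dom-S = λ i → trans (dom-eq i) (dom-S i)
    ; v-free = s-free ; root = root ; root∈R = root∈R ; ran-S = ran-S′
    ; unreached = λ s′ Ss′ new → keep s′ s′ (unreached s′ Ss′ (∨-false-l new))
                                   (λ { (refl , _) → true≢false-at reached new }) }
    where
    open Chain c
    s≢u : s ≢ u
    s≢u = D-distinct G s u arc
    open Rematch G matching is-match s s u (unreached s Ss s-new) v-free (D-edge G s u arc)
    s-free : ran rematched s ≡ false
    s-free rewrite ran-eq s | eqb-refl s | eqb-false s≢u | ∧-zeroʳ (ran matching s) = refl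
    ran-S′ : ∀ z → (ran rematched z ∨ eqb z s) ≡ (S z ∨ eqb z root)
    ran-S′ z = by-cases (z ≟ s)
      where
      by-cases : Dec (z ≡ s) → (ran rematched z ∨ eqb z s) ≡ (S z ∨ eqb z root)
      by-cases (yes refl) = trans (∨-r (ran rematched z) (eqb-refl z)) (sym (∨-l (eqb z root) Ss))
      by-cases (no z≢s) rewrite ran-eq z | eqb-false z≢s | ∧-identityʳ (ran matching z) | ∨-identityʳ (ran matching z ∨ eqb z u) = ran-S z

  chain-later : ∀ t v → Chain t v → Chain (suc t) v
  chain-later t v c = record
    { matching = matching ; is-match = is-match ; dom-S = dom-S ; v-free = v-free
    ; root = root ; root∈R = root∈R ; ran-S = ran-S
    ; unreached = λ s Ss new → unreached s Ss (∨-false-l new) }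
    where open Chain c

  chain : ∀ t v → iter Back t R v ≡ true → Chain t v
  chain zero v Rv = chain-base v Rv
  chain (suc t) v reached with step-cases Back _ v reached
  ... | inj₁ earlier = chain-later t v (chain t v earlier)
  ... | inj₂ (v-new , u , u-reached , back) =
    chain-step t v u v-new reached (proj₁ (∧-true back)) (proj₂ (∧-true {S v} back)) (chain t u u-reached)

  no-entering-arc : ∀ t v → R t ≡ false → S t ≡ false → B v ≡ true → D G t v ≡ true → ⊥
  no-entering-arc t v Rt St Bv arc = no-perfect (extend-small k G diag ext m₁ m₁-match small root ran⊆)
    where
    open Chain (chain (suc n) v Bv)
    m₁ : EdgeSet n
    m₁ = addEdge matching t v
    m₁-match : IsMatching G m₁
    m₁-match = addEdge-match G matching t v is-match (D-edge G t v arc) (trans (dom-S t) St) v-free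
    dom₁ : ∀ z → dom m₁ z ≡ (S z ∨ eqb z t)
    dom₁ z = trans (addEdge-dom matching t v z) (cong (_∨ eqb z t) (dom-S z))
    ran₁ : ∀ z → ran m₁ z ≡ (S z ∨ eqb z root)
    ran₁ z = trans (addEdge-ran matching t v z) (ran-S z)
    size₁ : count (dom m₁) ≡ suc (count S)
    size₁ = trans (count-ext _ _ dom₁) (count-insert S t St)
    small : count (dom m₁) ≤ k
    small = ≤-trans (≤-reflexive size₁) S-small
    ran⊆ : ∀ z → ran m₁ z ≡ true → (dom m₁ z ∨ eqb z root) ≡ true
    ran⊆ z e with ∨-true {S z} (trans (sym (ran₁ z)) e)
    ... | inj₁ Sz = ∨-l (eqb z root) (trans (dom₁ z) (∨-l (eqb z t) Sz))
    ... | inj₂ z≡root = ∨-r (dom m₁ z) z≡root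
    -- The perfect extension p maps R into R ∖ {root}.
    no-perfect : (∃ λ p → IsPerfectMatching G p × (m₁ ⊆ₑ p)) → ⊥
    no-perfect (p , p-perfect , m₁⊆p) = perfect-no-shrink G p p-perfect R root root∈R into
      where
      outside-m₁ : ∀ i j → R i ≡ true → p i j ≡ true → ran m₁ j ≡ false
      outside-m₁ i j Ri pij with ran m₁ j in eq
      ... | false = refl
      ... | true with ∨-true {S i} (trans (sym (dom₁ i)) (perfect-partner G m₁ p p-perfect m₁⊆p i j pij eq))
      ... | inj₁ Si = ⊥-elim (true≢false-at Si (R∩S i Ri))
      ... | inj₂ i≡t with eqb-true i≡t
      ... | refl = ⊥-elim (true≢false-at Ri Rt)
      into : ∀ i j → R i ≡ true → p i j ≡ true → (R j ∧ not (eqb j root)) ≡ true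
      into i j Ri pij = ∧-intro Rj (not-false (∨-false-r {S j} S∪root))
        where
        S∪root : (S j ∨ eqb j root) ≡ false
        S∪root = trans (sym (ran₁ j)) (outside-m₁ i j Ri pij)
        Rj : R j ≡ true
        Rj with i ≟ j
        ... | yes refl = Ri
        ... | no i≢j = R-closed i j Ri (D-arc G i j i≢j (proj₁ (proj₁ p-perfect) i j pij)) (∨-false-l S∪root)

  B-back-closed : BackClosed G B
  B-back-closed z v arc Bv with inspect-bool (S z) | inspect-bool (R z)
  ... | inj₁ Sz | _ = closure-closed Back R v z Bv (∧-intro Sz arc)
  ... | inj₂ _ | inj₁ Rz = closure-base Back R z Rz
  ... | inj₂ Sz | inj₂ Rz = ⊥-elim (no-entering-arc z v Rz Sz Bv arc)

  B⊆R∪S : ∀ z → B z ≡ true → (R z ∨ S z) ≡ true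
  B⊆R∪S = closure-all Back R _ (λ z Rz → ∨-l (S z) Rz) (λ i z back → ∨-r (R z) (proj₁ (∧-true back)))

  R-everything : ∀ x y → R x ≡ true → R y ≡ false → S y ≡ false → ⊥
  R-everything x y Rx Ry Sy = back-closed-trivial k (≤-trans (s≤s z≤n) S-small) G diag ext B B-back-closed x y
                                (closure-base Back R x Rx) By
    where
    By : B y ≡ false
    By with B y in eq
    ... | false = refl
    ... | true = ⊥-elim (true≢false-at (B⊆R∪S y eq) (cong₂ _∨_ Ry Sy))

module ReachableAvoiding {n} (G : BipGraph n) (S : Subset n) (x : Fin n) (x∉S : x ∉ S) where
  Arc : Fin n → Fin n → Bool
  Arc i j = not (member S i) ∧ (not (member S j) ∧ D G i j)

  R : Fin n → Bool
  R = closure Arc (λ i → eqb i x)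

  x∈R : R x ≡ true
  x∈R = closure-base Arc _ x (eqb-refl x)

  path : ∀ y → R y ≡ true → Star (ArcOutside (D G) S) x y
  path = closure-path _ Arc x outside
    where
    outside : ∀ i j → Arc i j ≡ true → ArcOutside (D G) S i j
    outside i j e with ∧-true {not (member S i)} e
    ... | i∉S , e′ with ∧-true {not (member S j)} e′
    ... | j∉S , arc = false-∉ S i (not-true i∉S) , false-∉ S j (not-true j∉S) , arc

  R∩S : ∀ i → R i ≡ true → member S i ≡ false
  R∩S = closure-all Arc _ _ (λ z p → subst (λ z → member S z ≡ false) (sym (eqb-true p)) (∉-false S x x∉S))
                            (λ i z e → not-true (proj₁ (∧-true (proj₂ (∧-true {not (member S i)} e)))))

  R-closed : ∀ i j → R i ≡ true → D G i j ≡ true → member S j ≡ false → R j ≡ true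
  R-closed i j Ri arc j∉S = closure-closed Arc _ i j Ri (∧-intro (not-false (R∩S i Ri)) (∧-intro (not-false j∉S) arc))

-- (T1): for |S| < k and x, y ∉ S, the set R of vertices reachable from x in
-- D - S is closed under the arcs of D - S, hence contains y.
extendable⇒strong : ∀ {n} k (G : BipGraph n) → (∀ i → G i i ≡ true) → Extendable k G → KStrong k (D G)
extendable⇒strong {n} k G diag ext = extendable-bound k n (proj₁ (proj₂ ext)) , large-separators
  where
  connects : ∀ S → suc ∣ S ∣ ≤ k → StrongWithout (D G) S
  connects S small x y x∉S y∉S x≢y with inspect-bool (R y)
    where open ReachableAvoiding G S x x∉S
  ... | inj₁ reached = ReachableAvoiding.path G S x x∉S y reached
  ... | inj₂ unreached = ⊥-elim (Rerouting.R-everything k G diag ext (member S)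
                                   (subst (λ c → suc c ≤ k) (card-count S) small) R R∩S R-closed x y x∈R unreached (∉-false S y y∉S))
    where open ReachableAvoiding G S x x∉S
  large-separators : ∀ S → IsSeparator (D G) S → k ≤ ∣ S ∣
  large-separators S separates with k ≤? ∣ S ∣
  ... | yes k≤S = k≤S
  ... | no k≰S = ⊥-elim (separates (connects S (≰⇒> k≰S)))

D-deleteEdge : ∀ {n} (G : BipGraph n) a b i j → deleteArc (D G) a b i j ≡ D (deleteEdge G a b) i j
D-deleteEdge G a b i j = ∧-assoc (not (eqb i j)) (G i j) _

KStrong-cong : ∀ {n} k (A A′ : Digraph n) → (∀ i j → A i j ≡ A′ i j) → KStrong k A → KStrong k A′
KStrong-cong k A A′ same (size , large) = size , λ S separates′ → large S (λ strong → separates′ (λ x y x∉S y∉S x≢y →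
  Star-map (λ { (i∉S , j∉S , arc) → i∉S , j∉S , trans (sym (same _ _)) arc }) (strong x y x∉S y∉S x≢y)))

deleteEdge-diag : ∀ {n} (G : BipGraph n) → (∀ i → G i i ≡ true) → ∀ a b → a ≢ b → ∀ i → deleteEdge G a b i i ≡ true
deleteEdge-diag G diag a b a≢b i with i ≟ a
... | no _ rewrite diag i = refl
... | yes refl rewrite diag i | eqb-false a≢b = refl

theorem5 : (k n : ℕ) → 1 ≤ k → (G : BipGraph n) →
           (∀ (i : Fin n) → G i i ≡ true) →
           MinimalExtendable k G → MinimalKStrong k (D G)
theorem5 k n k≥1 G diag (extendable , minimal) = extendable⇒strong k G diag extendable , arc-minimal
  where
  -- If D - (v_a → v_b) were k-strong, G - u_a w_b would be k-extendable by (T2).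
  arc-minimal : ∀ a b → D G a b ≡ true → ¬ KStrong k (deleteArc (D G) a b)
  arc-minimal a b arc strong′ = minimal a b (D-edge G a b arc)
    (strong⇒extendable k k≥1 (deleteEdge G a b) (deleteEdge-diag G diag a b (D-distinct G a b arc))
      (KStrong-cong k _ _ (D-deleteEdge G a b) strong′))
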